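{- For all footprints $l_1,l_2,l_3\in\mathcal{F}(\Sigma)$, if $l_1\circ l_2$ and $l_1\mathbin{\backslash\!\backslash}l_3$ are defined, then $(l_1\circ l_2)\mathbin{\backslash\!\backslash}l_3=(l_1\mathbin{\backslash\!\backslash}l_3)\circ l_2$.
   Context: $\Sigma$ is a separation algebra: a set with a partial binary operation $*$ that is commutative and associative (both sides defined and equal, or both undefined), cancellative (each partial map $\sigma*\cdot$ injective), with a unit $e$. The footprint of $\sigma$ is $\delta(\sigma)=\{\sigma'\in\Sigma\mid\forall\sigma''.\,(\sigma'*\sigma'')\text{ defined}\iff(\sigma*\sigma'')\text{ defined}\}$, and $\mathcal{F}(\Sigma)=\{\delta(\sigma)\mid\sigma\in\Sigma\}$. For footprints, $\delta(\sigma_1)\circ\delta(\sigma_2)=\delta(\sigma_1*\sigma_2)$ if $\sigma_1*\sigma_2$ is defined, and undefined otherwise (this is independent of representatives). Standing assumption: $*$ is cancellative on footprints, i.e. whenever $\sigma_1*\sigma_2$ and $\sigma_1'*\sigma_2'$ are defined, $\delta(\sigma_1*\sigma_2)=\delta(\sigma_1'*\sigma_2')$ and $\delta(\sigma_1)=\delta(\sigma_1')$ imply $\delta(\sigma_2)=\delta(\sigma_2')$. Footprint subtraction: $l_2\mathbin{\backslash\!\backslash}l_1=\delta(\sigma)$ if there are $\sigma_1,\sigma_2,\sigma$ with $l_1=\delta(\sigma_1)$, $l_2=\delta(\sigma_2)$, $\sigma_2=\sigma_1*\sigma$, and undefined otherwise (this is well defined). -}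

module Defs where

open import Data.Maybe using (Maybe; just; nothing; _>>=_)
open import Data.Product using (Σ; ∃; ∃-syntax; _×_; _,_)
open import Relation.Binary.PropositionalEquality using (_≡_)
open import Relation.Unary using (Pred; _≐_)
open import Function.Bundles using (_⇔_)
open import Level using (0ℓ)

Def : {A : Set} → Maybe A → Set
Def m = ∃[ x ] (m ≡ just x)

record SepAlg : Set₁ where
  infixl 7 _·_
  field
    Carrier : Set
    _·_     : Carrier → Carrier → Maybe Carrier
    e       : Carrier
    comm    : ∀ a b → a · b ≡ b · a
    -- (a*b)*c and a*(b*c): both defined and equal, or both undefined
    assoc   : ∀ a b c → (a · b >>= λ x → x · c) ≡ (b · c >>= λ y → a · y)
    cancel  : ∀ a b b' c → a · b ≡ just c → a · b' ≡ just c → b ≡ b'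
    unitˡ   : ∀ a → e · a ≡ just a

module _ (S : SepAlg) where
  open SepAlg S

  Footprint : Set₁
  Footprint = Pred Carrier 0ℓ

  δ : Carrier → Footprint
  δ σ σ' = ∀ σ'' → Def (σ' · σ'') ⇔ Def (σ · σ'')

  IsFootprint : Footprint → Set
  IsFootprint l = ∃[ σ ] (l ≐ δ σ)

  -- l₁ ∘ l₂ is defined and equals l
  Comp : Footprint → Footprint → Footprint → Set
  Comp l₁ l₂ l = Σ Carrier λ σ₁ → Σ Carrier λ σ₂ → Σ Carrier λ σ →
    (l₁ ≐ δ σ₁) × (l₂ ≐ δ σ₂) × (σ₁ · σ₂ ≡ just σ) × (l ≐ δ σ)

  -- l₂ \\ l₁ is defined and equals l
  Sub : Footprint → Footprint → Footprint → Set
  Sub l₂ l₁ l = Σ Carrier λ σ₁ → Σ Carrier λ σ₂ → Σ Carrier λ σ →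
    (l₁ ≐ δ σ₁) × (l₂ ≐ δ σ₂) × (σ₁ · σ ≡ just σ₂) × (l ≐ δ σ)

  CompDefined : Footprint → Footprint → Set₁
  CompDefined l₁ l₂ = Σ Footprint λ l → Comp l₁ l₂ l

  SubDefined : Footprint → Footprint → Set₁
  SubDefined l₂ l₁ = Σ Footprint λ l → Sub l₂ l₁ l

  FootprintCancellative : Set
  FootprintCancellative = ∀ σ₁ σ₂ σ₁' σ₂' s s' →
    σ₁ · σ₂ ≡ just s → σ₁' · σ₂' ≡ just s' →
    δ s ≐ δ s' → δ σ₁ ≐ δ σ₁' → δ σ₂ ≐ δ σ₂'

-- Write l₁ = δ σ₁, l₂ = δ σ₂ with σ₁ * σ₂ = σ, and l₁ = δ τ₂, l₃ = δ τ₁ with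
-- τ₂ = τ₁ * τ.  Since σ₁ and τ₂ have the same footprint, τ₂ * σ₂ = w is defined,
-- and δ w = δ σ because footprints are a congruence for *.  Associativity applied
-- to (τ₁ * τ) * σ₂ = w gives τ * σ₂ = v with τ₁ * v = w, so δ v is both
-- (l₁ ∘ l₂) \\ l₃ and (l₁ \\ l₃) ∘ l₂.
module Submission where

open import Defs
open import Data.Maybe using (Maybe; just; _>>=_)
open import Data.Maybe.Properties using (just-injective)
open import Data.Product using (Σ; _×_; _,_; ∃-syntax; proj₁)
open import Function.Bundles using (mk⇔; Equivalence)
open import Function.Properties.Equivalence using (⇔-isEquivalence)
open import Level using (0ℓ)
open import Relation.Binary.PropositionalEquality using (_≡_; refl; sym; trans; cong; subst; module ≡-Reasoning)
open import Relation.Binary.Structures using (IsEquivalence)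
open import Relation.Unary using (_≐_; _∈_)
open import Relation.Unary.Properties using (≐-refl; ≐-sym; ≐-trans)

open Equivalence using (to; from)
open IsEquivalence (⇔-isEquivalence {0ℓ}) using ()
  renaming (refl to ⇔-refl; sym to ⇔-sym; trans to ⇔-trans)

>>=-just-inv : ∀ {A B : Set} (m : Maybe A) {f : A → Maybe B} {b : B} →
  (m >>= f) ≡ just b → ∃[ a ] (m ≡ just a × f a ≡ just b)
>>=-just-inv (just a) eq = a , refl , eq

module SeparationAlgebra (S : SepAlg) where
  open SepAlg S

  ·-assocʳ : ∀ {a b c s t} → a · b ≡ just s → s · c ≡ just t →
    ∃[ u ] (b · c ≡ just u × a · u ≡ just t)
  ·-assocʳ {a} {b} {c} {s} {t} ab≡s sc≡t = >>=-just-inv (b · c) (begin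
    (b · c >>= a ·_)          ≡⟨ sym (assoc a b c) ⟩
    (a · b >>= λ x → x · c)   ≡⟨ cong (_>>= λ x → x · c) ab≡s ⟩
    s · c                     ≡⟨ sc≡t ⟩
    just t                    ∎)
    where open ≡-Reasoning

  ·-assocˡ : ∀ {a b c u t} → b · c ≡ just u → a · u ≡ just t →
    ∃[ s ] (a · b ≡ just s × s · c ≡ just t)
  ·-assocˡ {a} {b} {c} {u} {t} bc≡u au≡t = >>=-just-inv (a · b) (begin
    (a · b >>= λ x → x · c)   ≡⟨ assoc a b c ⟩
    (b · c >>= a ·_)          ≡⟨ cong (_>>= a ·_) bc≡u ⟩
    a · u                     ≡⟨ au≡t ⟩
    just t                    ∎)
    where open ≡-Reasoning

  δ-refl : ∀ σ → σ ∈ δ S σ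
  δ-refl σ _ = ⇔-refl

  δ-sym : ∀ {σ σ'} → σ' ∈ δ S σ → σ ∈ δ S σ'
  δ-sym σ'∈δσ c = ⇔-sym (σ'∈δσ c)

  ∈δ⇒δ≐ : ∀ {σ σ'} → σ' ∈ δ S σ → δ S σ ≐ δ S σ'
  ∈δ⇒δ≐ σ'∈δσ =
    (λ x∈δσ c → ⇔-trans (x∈δσ c) (⇔-sym (σ'∈δσ c))) ,
    (λ x∈δσ' c → ⇔-trans (x∈δσ' c) (σ'∈δσ c))

  ≐δ⇒∈δ : ∀ {l : Footprint S} {σ σ'} → l ≐ δ S σ → l ≐ δ S σ' → σ' ∈ δ S σ
  ≐δ⇒∈δ {σ' = σ'} l≐δσ l≐δσ' = proj₁ (≐-trans (≐-sym l≐δσ') l≐δσ) (δ-refl σ')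

  Def-·-respˡ-δ : ∀ {a a' b s s' c} → a' ∈ δ S a →
    a · b ≡ just s → a' · b ≡ just s' → Def (s · c) → Def (s' · c)
  Def-·-respˡ-δ a'∈δa ab≡s a'b≡s' (t , sc≡t) with ·-assocʳ ab≡s sc≡t
  ... | u , bc≡u , au≡t with from (a'∈δa u) (t , au≡t)
  ... | t' , a'u≡t' with ·-assocˡ bc≡u a'u≡t'
  ... | s'' , a'b≡s'' , s''c≡t' =
    subst (λ x → Def (x · _)) (just-injective (trans (sym a'b≡s'') a'b≡s')) (_ , s''c≡t')

  δ-·-congˡ : ∀ {a a' b s s'} → a' ∈ δ S a →
    a · b ≡ just s → a' · b ≡ just s' → s' ∈ δ S s
  δ-·-congˡ a'∈δa ab≡s a'b≡s' c =
    mk⇔ (Def-·-respˡ-δ (δ-sym a'∈δa) a'b≡s' ab≡s) (Def-·-respˡ-δ a'∈δa ab≡s a'b≡s')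

  sub-comp-exchange : ∀ {σ₁ σ₂ σ τ₁ τ τ₂} → σ₁ ∈ δ S τ₂ →
    σ₁ · σ₂ ≡ just σ → τ₁ · τ ≡ just τ₂ →
    ∃[ v ] ∃[ w ] (τ · σ₂ ≡ just v × τ₁ · v ≡ just w × δ S σ ≐ δ S w)
  sub-comp-exchange σ₁∈δτ₂ σ₁σ₂≡σ τ₁τ≡τ₂ with to (σ₁∈δτ₂ _) (_ , σ₁σ₂≡σ)
  ... | w , τ₂σ₂≡w with ·-assocʳ τ₁τ≡τ₂ τ₂σ₂≡w
  ... | v , τσ₂≡v , τ₁v≡w =
    v , w , τσ₂≡v , τ₁v≡w , ∈δ⇒δ≐ (δ-·-congˡ (δ-sym σ₁∈δτ₂) σ₁σ₂≡σ τ₂σ₂≡w)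

-- Cancellativity on footprints only makes \\ single-valued; Sub is a relation,
-- so the identity holds without it.
proposition2p7 : (S : SepAlg) → FootprintCancellative S →
    (l₁ l₂ l₃ : Footprint S) →
    IsFootprint S l₁ → IsFootprint S l₂ → IsFootprint S l₃ →
    CompDefined S l₁ l₂ → SubDefined S l₁ l₃ →
    Σ (Footprint S) λ a → Σ (Footprint S) λ b → Σ (Footprint S) λ c →
    Comp S l₁ l₂ a × Sub S a l₃ b × Sub S l₁ l₃ c × Comp S c l₂ b
proposition2p7 S _ l₁ l₂ l₃ _ _ _
  (a , σ₁ , σ₂ , σ , l₁≐δσ₁ , l₂≐δσ₂ , σ₁σ₂≡σ , a≐δσ)
  (c , τ₁ , τ₂ , τ , l₃≐δτ₁ , l₁≐δτ₂ , τ₁τ≡τ₂ , c≐δτ)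
  with sub-comp-exchange (≐δ⇒∈δ l₁≐δτ₂ l₁≐δσ₁) σ₁σ₂≡σ τ₁τ≡τ₂
  where open SeparationAlgebra S
... | v , w , τσ₂≡v , τ₁v≡w , δσ≐δw =
  a , δ S v , c ,
  (σ₁ , σ₂ , σ , l₁≐δσ₁ , l₂≐δσ₂ , σ₁σ₂≡σ , a≐δσ) ,
  (τ₁ , w , v , l₃≐δτ₁ , ≐-trans a≐δσ δσ≐δw , τ₁v≡w , ≐-refl) ,
  (τ₁ , τ₂ , τ , l₃≐δτ₁ , l₁≐δτ₂ , τ₁τ≡τ₂ , c≐δτ) ,
  (τ , σ₂ , v , c≐δτ , l₂≐δσ₂ , τσ₂≡v , ≐-refl)
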